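{- Let $s$ be a sequent (an unordered pair of formulas in negation normal form) and let $A$ be a finite set of such sequents (the axioms). The procedure $\mathrm{prove}(s, A)$ described in the context terminates and returns $\mathsf{true}$ if and only if $s$ has a derivation from the axioms in $A$ in the proof system described in the context.
   Context: Formulas in negation normal form (NNF) are built from literals $x$ and $\neg x$ ($x$ ranging over a set of propositional variables) using binary $\wedge$ and $\vee$. For an NNF formula $\gamma$, its inverse $\gamma'$ is the NNF of $\neg\gamma$: $x' = \neg x$, $(\neg x)' = x$, $(\phi\wedge\psi)' = \phi'\vee\psi'$, and $(\phi\vee\psi)' = \phi'\wedge\psi'$. A sequent is an unordered pair $\{\phi,\psi\}$ of NNF formulas, possibly with $\phi=\psi$; it is also written $(\phi,\psi)$, and it corresponds to an orthologic sequent in which both formulas are on the right. Proof system (orthologic restricted to right-only NNF sequents) with axiom set $A$. Its rules are: (Ax) every sequent in $A$ is derivable; (Hyp) $(x,\neg x)$ is derivable for every variable $x$; (Cut) from $(\phi,\gamma)$ and $(\gamma',\psi)$ derive $(\phi,\psi)$; (Replace) from $(\Gamma,\Gamma)$ derive $(\Gamma,\Delta)$ for any $\Delta$; ($\wedge$-R) from $(\Gamma,\phi)$ and $(\Gamma,\psi)$ derive $(\Gamma,\phi\wedge\psi)$; ($\vee$-R) from $(\Gamma,\phi)$ derive $(\Gamma,\phi\vee\psi)$, and from $(\Gamma,\psi)$ derive $(\Gamma,\phi\vee\psi)$. The procedure $\mathrm{prove}(s,A)$: Initialization. - Let $SF$ be the set of all subformulas of the formulas in $s$ and in the sequents of $A$,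 enlarged by all subformulas of the inverses of these formulas. - Let $AF=\{a,b,a',b' : (a,b)\in A\}$. - Let $X$ be the set of variables occurring in the input. - The set $P$ of proven sequents and a worklist stack $W$ are both initialized to $A\cup\{(x,\neg x): x\in X\}$. - A map $P_{Cut}$ from formulas to sets of formulas and a map $P_\wedge$ from pairs of formulas to sets of formulas start empty; an absent entry means the empty set. - For each $a$, let $SF_\wedge(a)=\{b : \text{a conjunction of } a \text{ and } b \text{ lies in } SF\}$ and $SF_\vee(a)=\{\phi\in SF : \phi \text{ is a disjunction with } a \text{ as one disjunct}\}$. Main loop. While $W$ is nonempty: - Pop $(a,b)$ from $W$. If $\{a,b\}=s$, return $\mathsf{true}$. - If $a\in AF$, add $b$ to $P_{Cut}(a')$. If $b\in AF$, add $a$ to $P_{Cut}(b')$. - For each $\psi\in SF_\wedge(a)$, add the conjunction $a\wedge\psi$ (as it occurs in $SF$) to $P_\wedge(b,\psi)$. Symmetrically, for each $\psi\in SF_\wedge(b)$, add $b\wedge\psi$ to $P_\wedge(a,\psi)$. - For each $\phi\in SF_\vee(a)\cup P_\wedge(b,a)\cup P_{Cut}(a)$ with $(\phi,b)\notin P$, add $(\phi,b)$ to $P$ and push it on $W$. - For each $\phi\in SF_\vee(b)\cup P_\wedge(a,b)\cup P_{Cut}(b)$ with $(a,\phi)\notin P$, add $(a,\phi)$ to $P$ and push it on $W$. - If $a=b$: for each $\phi\in SF$ with $(\phi,a)\notin P$, add $(\phi,a)$ to $P$ and push it on $W$. When $W$ becomes empty, return $\mathsf{false}$. -}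

module Defs where

open import Data.Nat using (ℕ; zero; suc; _≡ᵇ_)
open import Data.Bool using (Bool; true; false; if_then_else_; not) renaming (_∧_ to _&&_; _∨_ to _||_)
open import Data.List using (List; []; _∷_; _++_; map; concatMap; foldl)
open import Data.Product using (_×_; _,_; proj₁; proj₂)
open import Data.Maybe using (Maybe; just; nothing)
open import Data.List.Membership.Propositional using (_∈_)
open import Function using (id; _∘_)

infixr 6 _∧_
infixr 5 _∨_

data Fm : Set where
  pos : ℕ → Fm
  neg : ℕ → Fm
  _∧_ : Fm → Fm → Fm
  _∨_ : Fm → Fm → Fm

inv : Fm → Fm
inv (pos x) = neg x
inv (neg x) = pos x
inv (φ ∧ ψ) = inv φ ∨ inv ψ
inv (φ ∨ ψ) = inv φ ∧ inv ψ

-- A sequent (φ , ψ); it stands for the unordered pair {φ , ψ}.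
Seq : Set
Seq = Fm × Fm

-- Since sequents are unordered pairs, derivability is closed under
-- swapping the two components (constructor `swap`), and every rule
-- may be applied to either ordering.

data Der (A : List Seq) : Fm → Fm → Set where
  ax      : ∀ {φ ψ} → (φ , ψ) ∈ A → Der A φ ψ
  hyp     : ∀ x → Der A (pos x) (neg x)
  swap    : ∀ {φ ψ} → Der A φ ψ → Der A ψ φ
  cut     : ∀ {φ γ ψ} → Der A φ γ → Der A (inv γ) ψ → Der A φ ψ
  replace : ∀ {Γ Δ} → Der A Γ Γ → Der A Γ Δ
  ∧R      : ∀ {Γ φ ψ} → Der A Γ φ → Der A Γ ψ → Der A Γ (φ ∧ ψ)
  ∨R₁     : ∀ {Γ φ ψ} → Der A Γ φ → Der A Γ (φ ∨ ψ)
  ∨R₂     : ∀ {Γ φ ψ} → Der A Γ ψ → Der A Γ (φ ∨ ψ)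

Derivable : List Seq → Seq → Set
Derivable A s = Der A (proj₁ s) (proj₂ s)

eqF : Fm → Fm → Bool
eqF (pos x) (pos y) = x ≡ᵇ y
eqF (neg x) (neg y) = x ≡ᵇ y
eqF (a ∧ b) (c ∧ d) = eqF a c && eqF b d
eqF (a ∨ b) (c ∨ d) = eqF a c && eqF b d
eqF _ _ = false

eqS : Seq → Seq → Bool
eqS (a , b) (c , d) = (eqF a c && eqF b d) || (eqF a d && eqF b c)

anyB : {X : Set} → (X → Bool) → List X → Bool
anyB p [] = false
anyB p (x ∷ xs) = p x || anyB p xs

filterB : {X : Set} → (X → Bool) → List X → List X
filterB p [] = []
filterB p (x ∷ xs) = if p x then x ∷ filterB p xs else filterB p xs

memF : Fm → List Fm → Bool
memF x = anyB (eqF x)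

memS : Seq → List Seq → Bool
memS q = anyB (eqS q)

insertF : Fm → List Fm → List Fm
insertF x l = if memF x l then l else x ∷ l

dedupS : List Seq → List Seq
dedupS = foldl (λ acc q → if memS q acc then acc else q ∷ acc) []

sub : Fm → List Fm
sub (pos x) = pos x ∷ []
sub (neg x) = neg x ∷ []
sub (φ ∧ ψ) = (φ ∧ ψ) ∷ sub φ ++ sub ψ
sub (φ ∨ ψ) = (φ ∨ ψ) ∷ sub φ ++ sub ψ

vars : Fm → List ℕ
vars (pos x) = x ∷ []
vars (neg x) = x ∷ []
vars (φ ∧ ψ) = vars φ ++ vars ψ
vars (φ ∨ ψ) = vars φ ++ vars ψ

-- The procedure prove(s, A), run with an explicit fuel bound
-- (one unit of fuel = one iteration of the main loop).

record State : Set where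
  constructor st
  field
    P    : List Seq               -- proven sequents
    W    : List Seq               -- worklist (stack, head = top)
    pcut : Fm → List Fm
    pand : Fm → Fm → List Fm
open State public

module Procedure (s : Seq) (A : List Seq) where

  inputFms : List Fm
  inputFms = proj₁ s ∷ proj₂ s ∷ concatMap (λ q → proj₁ q ∷ proj₂ q ∷ []) A

  SF : List Fm
  SF = concatMap (λ φ → sub φ ++ sub (inv φ)) inputFms

  AF : List Fm
  AF = concatMap (λ q → proj₁ q ∷ proj₂ q ∷ inv (proj₁ q) ∷ inv (proj₂ q) ∷ []) A

  X : List ℕ
  X = concatMap vars inputFms

  initSet : List Seq
  initSet = dedupS (A ++ map (λ x → pos x , neg x) X)

  initState : State
  initState = st initSet initSet (λ _ → []) (λ _ _ → [])

  addCut : Fm → Fm → (Fm → List Fm) → (Fm → List Fm)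
  addCut k v f k' = if eqF k' k then insertF v (f k) else f k'

  addAnd : Fm → Fm → Fm → (Fm → Fm → List Fm) → (Fm → Fm → List Fm)
  addAnd k₁ k₂ v g x y = if eqF x k₁ && eqF y k₂ then insertF v (g x y) else g x y

  conjUpd : Fm → Fm → (Fm → Fm → List Fm) → (Fm → Fm → List Fm)
  conjUpd a b g = foldl step g SF
    where
    step : (Fm → Fm → List Fm) → Fm → (Fm → Fm → List Fm)
    step h (l ∧ r) = (if eqF r a then addAnd b l (l ∧ r) else id)
                       ((if eqF l a then addAnd b r (l ∧ r) else id) h)
    step h _ = h

  disj : Fm → List Fm
  disj a = filterB isD SF
    where
    isD : Fm → Bool
    isD (l ∨ r) = eqF l a || eqF r a
    isD _ = false

  addNew : List Seq × List Seq → Seq → List Seq × List Seq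
  addNew (P , W) q = if memS q P then (P , W) else (q ∷ P , q ∷ W)

  process : Seq → List Seq → State → State
  process (a , b) rest (st P₀ _ pc₀ pa₀) = st P₃ W₃ pc₂ pa₂
    where
    pc₁ = if memF a AF then addCut (inv a) b pc₀ else pc₀
    pc₂ = if memF b AF then addCut (inv b) a pc₁ else pc₁
    pa₁ = conjUpd a b pa₀
    pa₂ = conjUpd b a pa₁
    PW₁ = foldl addNew (P₀ , rest) (map (λ φ → φ , b) (disj a ++ pa₂ b a ++ pc₂ a))
    PW₂ = foldl addNew PW₁ (map (λ φ → a , φ) (disj b ++ pa₂ a b ++ pc₂ b))
    PW₃ = foldl addNew PW₂ (map (λ φ → φ , a) (if eqF a b then SF else []))
    P₃ = proj₁ PW₃
    W₃ = proj₂ PW₃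

  -- run the main loop with at most n iterations;
  -- nothing = not yet terminated
  run : ℕ → State → Maybe Bool
  run zero _ = nothing
  run (suc n) σ with W σ
  ... | [] = just false
  ... | q ∷ rest = if eqS q s then just true else run n (process q rest σ)

prove : ℕ → Seq → List Seq → Maybe Bool
prove n s A = Procedure.run s A n (Procedure.initState s A)

module Submission where

-- Every sequent placed in P is derivable: it is an axiom, a hypothesis, or follows by one rule
-- from popped sequents, the tables P_Cut and P_∧ recording exactly which popped sequents can be
-- the other premise of a cut or a ∧-rule.  P stays duplicate-free inside SF × SF while every
-- iteration pops W, so |W| − |P| decreases and the loop stops.  When W is empty, P is closed
-- under the rules restricted to SF with cuts restricted to AF.  By cut elimination every
-- derivation can be turned into one cutting only on formulas of AF (a set closed under inverses
-- that contains the axiom formulas), and such a derivation of a sequent over SF uses only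
-- formulas of SF, so its conclusion lies in P.

open import Defs hiding (cut; replace)
open import Data.Bool using (Bool; true; false; if_then_else_) renaming (_∧_ to _∧ᵇ_; _∨_ to _∨ᵇ_)
open import Data.List using (List; []; _∷_; [_]; _++_; length; foldl; map; cartesianProduct)
open import Data.List.Membership.Propositional using (_∈_; find; lose)
open import Data.List.Membership.Propositional.Properties
  using (∈-++⁺ˡ; ∈-++⁺ʳ; ∈-++⁻; ∈-concatMap⁺; ∈-concatMap⁻; ∈-map⁺; ∈-map⁻; ∈-cartesianProduct⁺)
open import Data.List.Properties using (foldl-cong; foldl-++; ++-assoc; ++-identityʳ; length-++)
open import Data.List.Relation.Binary.Subset.Propositional using (_⊆_)
open import Data.List.Relation.Binary.Subset.Propositional.Properties using (Any-resp-⊆; xs⊆ys++xs)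
open import Data.List.Relation.Unary.All as All using ()
open import Data.List.Relation.Unary.All.Properties using (¬Any⇒All¬)
open import Data.List.Relation.Unary.AllPairs as AllPairs using (AllPairs; []; _∷_)
open import Data.List.Relation.Unary.Any as Any using (Any; here; there)
open import Data.List.Relation.Unary.Unique.Propositional using (Unique)
open import Data.Maybe using (just)
open import Data.Nat using (ℕ; zero; suc; _+_; _≤_; _<_; _⊔_; s≤s; s≤s⁻¹; z≤n)
open import Data.Nat.Properties
  using ( m≤m⊔n; m≤n⊔m; ≡ᵇ⇒≡; ≡⇒≡ᵇ; ≤-trans; ≤-reflexive; +-assoc; +-suc; +-identityʳ; +-monoʳ-<
        ; m+n≮n; n<1+n)
open import Data.Product as Product using (Σ; _×_; _,_; proj₁; proj₂; ∃-syntax; uncurry)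
open import Data.Product.Properties using (,-injective)
open import Data.Sum as Sum using (_⊎_; inj₁; inj₂)
open import Function using (_∘_; id)
open import Function.Bundles using (_⇔_; mk⇔)
open import Relation.Nullary using (yes; no; ¬_; contradiction; _because_)
open import Relation.Nullary.Reflects
  using (Reflects; ofʸ; ofⁿ; fromEquivalence; _×-reflects_; _⊎-reflects_)
open import Relation.Unary using (Decidable)
open import Relation.Binary.PropositionalEquality
  using (_≡_; _≢_; refl; sym; trans; cong; cong₂; subst; ≢-sym)

variable
  k k′ m m′ n n′ x : ℕ
  φ ψ χ γ δ Γ Δ : Fm
  q r t : Seq
  ls : List Fm
  qs : List Seq

inv-involutive : ∀ φ → inv (inv φ) ≡ φ
inv-involutive (pos x) = refl
inv-involutive (neg x) = refl
inv-involutive (φ ∧ ψ) = cong₂ _∧_ (inv-involutive φ) (inv-involutive ψ)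
inv-involutive (φ ∨ ψ) = cong₂ _∨_ (inv-involutive φ) (inv-involutive ψ)

data Rank : ℕ → Fm → Set where
  pos : ∀ x → Rank k (pos x)
  neg : ∀ x → Rank k (neg x)
  _∧_ : Rank k φ → Rank k ψ → Rank (suc k) (φ ∧ ψ)
  _∨_ : Rank k φ → Rank k ψ → Rank (suc k) (φ ∨ ψ)

rank-inv : Rank k φ → Rank k (inv φ)
rank-inv (pos x)  = neg x
rank-inv (neg x)  = pos x
rank-inv (r ∧ r′) = rank-inv r ∨ rank-inv r′
rank-inv (r ∨ r′) = rank-inv r ∧ rank-inv r′

rank-mono : k ≤ n → Rank k φ → Rank n φ
rank-mono _         (pos x)  = pos x
rank-mono _         (neg x)  = neg x
rank-mono (s≤s k≤n) (r ∧ r′) = rank-mono k≤n r ∧ rank-mono k≤n r′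
rank-mono (s≤s k≤n) (r ∨ r′) = rank-mono k≤n r ∨ rank-mono k≤n r′

rank : ∀ φ → ∃[ k ] Rank k φ
rank (pos x) = 0 , pos x
rank (neg x) = 0 , neg x
rank (φ ∧ ψ) with rank φ | rank ψ
... | j , r | k , r′ = suc (j ⊔ k) , rank-mono (m≤m⊔n j k) r ∧ rank-mono (m≤n⊔m j k) r′
rank (φ ∨ ψ) with rank φ | rank ψ
... | j , r | k , r′ = suc (j ⊔ k) , rank-mono (m≤m⊔n j k) r ∨ rank-mono (m≤n⊔m j k) r′

-- Cut elimination down to a set of cut formulas containing the axioms

module AnalyticCalculus
  (A : List Seq) (Cuttable : Fm → Set) (cuttable? : Decidable Cuttable)
  (cuttable-inv : ∀ {γ} → Cuttable γ → Cuttable (inv γ))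
  (axiom-cuttable : ∀ {φ ψ} → (φ , ψ) ∈ A → Cuttable φ × Cuttable ψ) where

  not-cuttable-inv : ¬ Cuttable γ → ¬ Cuttable (inv γ)
  not-cuttable-inv {γ} ¬c c = ¬c (subst Cuttable (inv-involutive γ) (cuttable-inv c))

  module Bounded where

    -- φ ⊢[ n ] ψ : derivations of (φ , ψ) of height at most n (leaves exist at every height) that
    -- cut only on Cuttable formulas.  Each rule comes in both orientations, so that exchange is
    -- admissible and height-preserving: sequents behave as unordered pairs.
    infix 4 _⊢[_]_
    data _⊢[_]_ : Fm → ℕ → Fm → Set where
      ax       : (φ , ψ) ∈ A → φ ⊢[ n ] ψ
      ax˘      : (φ , ψ) ∈ A → ψ ⊢[ n ] φ
      hyp      : ∀ x → pos x ⊢[ n ] neg x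
      hyp˘     : ∀ x → neg x ⊢[ n ] pos x
      cut      : Cuttable γ → φ ⊢[ n ] γ → inv γ ⊢[ n ] ψ → φ ⊢[ suc n ] ψ
      replace  : Γ ⊢[ n ] Γ → Γ ⊢[ suc n ] Δ
      replace˘ : Γ ⊢[ n ] Γ → Δ ⊢[ suc n ] Γ
      ∧ʳ       : Γ ⊢[ n ] φ → Γ ⊢[ n ] ψ → Γ ⊢[ suc n ] φ ∧ ψ
      ∧ˡ       : φ ⊢[ n ] Γ → ψ ⊢[ n ] Γ → φ ∧ ψ ⊢[ suc n ] Γ
      ∨₁ʳ      : Γ ⊢[ n ] φ → Γ ⊢[ suc n ] φ ∨ ψ
      ∨₂ʳ      : Γ ⊢[ n ] ψ → Γ ⊢[ suc n ] φ ∨ ψ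
      ∨₁ˡ      : φ ⊢[ n ] Γ → φ ∨ ψ ⊢[ suc n ] Γ
      ∨₂ˡ      : ψ ⊢[ n ] Γ → φ ∨ ψ ⊢[ suc n ] Γ

    invˡ : φ ⊢[ n ] ψ → inv (inv φ) ⊢[ n ] ψ
    invˡ {φ = φ} = subst (_⊢[ _ ] _) (sym (inv-involutive φ))

    exchange : φ ⊢[ n ] ψ → ψ ⊢[ n ] φ
    exchange (ax p)       = ax˘ p
    exchange (ax˘ p)      = ax p
    exchange (hyp x)      = hyp˘ x
    exchange (hyp˘ x)     = hyp x
    exchange (cut c d e)  = cut (cuttable-inv c) (exchange e) (invˡ (exchange d))
    exchange (replace d)  = replace˘ d
    exchange (replace˘ d) = replace d
    exchange (∧ʳ d e)     = ∧ˡ (exchange d) (exchange e)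
    exchange (∧ˡ d e)     = ∧ʳ (exchange d) (exchange e)
    exchange (∨₁ʳ d)      = ∨₁ˡ (exchange d)
    exchange (∨₂ʳ d)      = ∨₂ˡ (exchange d)
    exchange (∨₁ˡ d)      = ∨₁ʳ (exchange d)
    exchange (∨₂ˡ d)      = ∨₂ʳ (exchange d)

    raise : m ≤ n → φ ⊢[ m ] ψ → φ ⊢[ n ] ψ
    raise _         (ax p)       = ax p
    raise _         (ax˘ p)      = ax˘ p
    raise _         (hyp x)      = hyp x
    raise _         (hyp˘ x)     = hyp˘ x
    raise (s≤s m≤n) (cut c d e)  = cut c (raise m≤n d) (raise m≤n e)
    raise (s≤s m≤n) (replace d)  = replace (raise m≤n d)
    raise (s≤s m≤n) (replace˘ d) = replace˘ (raise m≤n d)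
    raise (s≤s m≤n) (∧ʳ d e)     = ∧ʳ (raise m≤n d) (raise m≤n e)
    raise (s≤s m≤n) (∧ˡ d e)     = ∧ˡ (raise m≤n d) (raise m≤n e)
    raise (s≤s m≤n) (∨₁ʳ d)      = ∨₁ʳ (raise m≤n d)
    raise (s≤s m≤n) (∨₂ʳ d)      = ∨₂ʳ (raise m≤n d)
    raise (s≤s m≤n) (∨₁ˡ d)      = ∨₁ˡ (raise m≤n d)
    raise (s≤s m≤n) (∨₂ˡ d)      = ∨₂ˡ (raise m≤n d)

  open Bounded using (_⊢[_]_)

  infix 4 _⊩_
  _⊩_ : Fm → Fm → Set
  φ ⊩ ψ = ∃[ n ] φ ⊢[ n ] ψ

  ⌊_⌋ : φ ⊢[ n ] ψ → φ ⊩ ψ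
  ⌊ d ⌋ = _ , d

  module ⊩ where

    private
      common : φ ⊩ ψ → Γ ⊩ Δ → ∃[ n ] (φ ⊢[ n ] ψ × Γ ⊢[ n ] Δ)
      common (m , d) (n , e) = m ⊔ n , Bounded.raise (m≤m⊔n m n) d , Bounded.raise (m≤n⊔m m n) e

    exchange : φ ⊩ ψ → ψ ⊩ φ
    exchange (n , d) = n , Bounded.exchange d

    cut : Cuttable γ → φ ⊩ γ → inv γ ⊩ ψ → φ ⊩ ψ
    cut c d e with common d e
    ... | n , d′ , e′ = suc n , Bounded.cut c d′ e′

    replace : Γ ⊩ Γ → Γ ⊩ Δ
    replace (n , d) = suc n , Bounded.replace d

    replace˘ : Γ ⊩ Γ → Δ ⊩ Γ
    replace˘ (n , d) = suc n , Bounded.replace˘ d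

    ∧ʳ : Γ ⊩ φ → Γ ⊩ ψ → Γ ⊩ φ ∧ ψ
    ∧ʳ d e with common d e
    ... | n , d′ , e′ = suc n , Bounded.∧ʳ d′ e′

    ∧ˡ : φ ⊩ Γ → ψ ⊩ Γ → φ ∧ ψ ⊩ Γ
    ∧ˡ d e with common d e
    ... | n , d′ , e′ = suc n , Bounded.∧ˡ d′ e′

    ∨₁ʳ : Γ ⊩ φ → Γ ⊩ φ ∨ ψ
    ∨₁ʳ (n , d) = suc n , Bounded.∨₁ʳ d

    ∨₂ʳ : Γ ⊩ ψ → Γ ⊩ φ ∨ ψ
    ∨₂ʳ (n , d) = suc n , Bounded.∨₂ʳ d

    ∨₁ˡ : φ ⊩ Γ → φ ∨ ψ ⊩ Γ
    ∨₁ˡ (n , d) = suc n , Bounded.∨₁ˡ d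

    ∨₂ˡ : ψ ⊩ Γ → φ ∨ ψ ⊩ Γ
    ∨₂ˡ (n , d) = suc n , Bounded.∨₂ˡ d

  open Bounded

  contract : Cuttable δ → δ ⊩ δ → inv δ ⊩ ψ → ψ ⊩ ψ
  contract c d e = ⊩.cut c (⊩.exchange (⊩.cut c d e)) e

  explode : Cuttable δ → δ ⊩ δ → inv δ ⊩ inv δ → ψ ⊩ ψ
  explode c d e = ⊩.cut c (⊩.exchange (⊩.replace d)) (⊩.replace e)

  -- Induction on the rank of the cut formula, then on the heights of the two premises.  Replace
  -- turns a cut into one against a contracted sequent (γ , γ) (eliminate₁), and the contracted
  -- sequents (γ , γ) and (inv γ , inv γ) together yield every (ψ , ψ) (eliminate₀).  In each
  -- eliminate function, the clauses after those splitting on d only meet a d that ends with a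
  -- logical rule on γ.
  mutual

    cut-admissible : Rank k γ → φ ⊢[ m ] γ → inv γ ⊢[ n ] ψ → φ ⊩ ψ
    cut-admissible {γ = γ} r d e with cuttable? γ
    ... | yes c = ⊩.cut c ⌊ d ⌋ ⌊ e ⌋
    ... | no ¬c = eliminate r ¬c d e

    cut-admissible₀ : Rank k γ → γ ⊢[ m ] γ → inv γ ⊢[ n ] inv γ → ψ ⊩ ψ
    cut-admissible₀ {γ = γ} r d e with cuttable? γ
    ... | yes c = explode c ⌊ d ⌋ ⌊ e ⌋
    ... | no ¬c = eliminate₀ r ¬c d e

    eliminate : Rank k γ → ¬ Cuttable γ → φ ⊢[ m ] γ → inv γ ⊢[ n ] ψ → φ ⊩ ψ
    eliminate r ¬c (ax p)        e = contradiction (proj₂ (axiom-cuttable p)) ¬c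
    eliminate r ¬c (ax˘ p)       e = contradiction (proj₁ (axiom-cuttable p)) ¬c
    eliminate r ¬c (hyp x)       e = ⌊ e ⌋
    eliminate r ¬c (hyp˘ x)      e = ⌊ e ⌋
    eliminate r ¬c (cut c d₁ d₂) e = ⊩.cut c ⌊ d₁ ⌋ (eliminate r ¬c d₂ e)
    eliminate r ¬c (replace d)   e = ⊩.replace ⌊ d ⌋
    eliminate r ¬c (replace˘ d)  e = ⊩.replace˘ (eliminate₁ r ¬c d e)
    eliminate r ¬c (∧ˡ d₁ d₂)    e = ⊩.∧ˡ (eliminate r ¬c d₁ e) (eliminate r ¬c d₂ e)
    eliminate r ¬c (∨₁ˡ d)       e = ⊩.∨₁ˡ (eliminate r ¬c d e)
    eliminate r ¬c (∨₂ˡ d)       e = ⊩.∨₂ˡ (eliminate r ¬c d e)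
    eliminate (r₁ ∧ _)  ¬c (∧ʳ d₁ _) (∨₁ˡ e)    = cut-admissible r₁ d₁ e
    eliminate (_ ∧ r₂)  ¬c (∧ʳ _ d₂) (∨₂ˡ e)    = cut-admissible r₂ d₂ e
    eliminate (r₁ ∨ _)  ¬c (∨₁ʳ d)   (∧ˡ e₁ _)  = cut-admissible r₁ d e₁
    eliminate (_ ∨ r₂)  ¬c (∨₂ʳ d)   (∧ˡ _ e₂)  = cut-admissible r₂ d e₂
    eliminate r ¬c d (ax p)        = contradiction (proj₁ (axiom-cuttable p)) (not-cuttable-inv ¬c)
    eliminate r ¬c d (ax˘ p)       = contradiction (proj₂ (axiom-cuttable p)) (not-cuttable-inv ¬c)
    eliminate r ¬c d (cut c e₁ e₂) = ⊩.cut c (eliminate r ¬c d e₁) ⌊ e₂ ⌋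
    eliminate r ¬c d (replace e)   =
      ⊩.replace (eliminate₁ (rank-inv r) (not-cuttable-inv ¬c) e (invˡ (exchange d)))
    eliminate r ¬c d (replace˘ e)  = ⊩.replace˘ ⌊ e ⌋
    eliminate r ¬c d (∧ʳ e₁ e₂)    = ⊩.∧ʳ (eliminate r ¬c d e₁) (eliminate r ¬c d e₂)
    eliminate r ¬c d (∨₁ʳ e)       = ⊩.∨₁ʳ (eliminate r ¬c d e)
    eliminate r ¬c d (∨₂ʳ e)       = ⊩.∨₂ʳ (eliminate r ¬c d e)

    cut-on : Rank k δ → δ ⊩ ψ → inv δ ⊢[ n ] ψ → ψ ⊩ ψ
    cut-on r (_ , d) e = cut-admissible r (exchange d) e

    eliminate₁ : Rank k γ → ¬ Cuttable γ → γ ⊢[ m ] γ → inv γ ⊢[ n ] ψ → ψ ⊩ ψ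
    eliminate₁ r ¬c (ax p)        e = contradiction (proj₁ (axiom-cuttable p)) ¬c
    eliminate₁ r ¬c (ax˘ p)       e = contradiction (proj₁ (axiom-cuttable p)) ¬c
    eliminate₁ r ¬c (cut c d₁ d₂) e =
      ⊩.cut c (⊩.exchange (eliminate r ¬c (exchange d₁) e)) (eliminate r ¬c d₂ e)
    eliminate₁ r ¬c (replace d)   e = eliminate₁ r ¬c d e
    eliminate₁ r ¬c (replace˘ d)  e = eliminate₁ r ¬c d e
    eliminate₁ r@(r₁ ∧ _) ¬c (∧ʳ d₁ _) e@(∨₁ˡ e₁)  = cut-on r₁ (eliminate r ¬c (exchange d₁) e) e₁
    eliminate₁ r@(_ ∧ r₂) ¬c (∧ʳ _ d₂) e@(∨₂ˡ e₂)  = cut-on r₂ (eliminate r ¬c (exchange d₂) e) e₂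
    eliminate₁ r@(r₁ ∧ _) ¬c (∧ˡ d₁ _) e@(∨₁ˡ e₁)  = cut-on r₁ (eliminate r ¬c d₁ e) e₁
    eliminate₁ r@(_ ∧ r₂) ¬c (∧ˡ _ d₂) e@(∨₂ˡ e₂)  = cut-on r₂ (eliminate r ¬c d₂ e) e₂
    eliminate₁ r@(r₁ ∨ _) ¬c (∨₁ʳ d)   e@(∧ˡ e₁ _) = cut-on r₁ (eliminate r ¬c (exchange d) e) e₁
    eliminate₁ r@(_ ∨ r₂) ¬c (∨₂ʳ d)   e@(∧ˡ _ e₂) = cut-on r₂ (eliminate r ¬c (exchange d) e) e₂
    eliminate₁ r@(r₁ ∨ _) ¬c (∨₁ˡ d)   e@(∧ˡ e₁ _) = cut-on r₁ (eliminate r ¬c d e) e₁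
    eliminate₁ r@(_ ∨ r₂) ¬c (∨₂ˡ d)   e@(∧ˡ _ e₂) = cut-on r₂ (eliminate r ¬c d e) e₂
    eliminate₁ r ¬c d (ax p)        = contradiction (proj₁ (axiom-cuttable p)) (not-cuttable-inv ¬c)
    eliminate₁ r ¬c d (ax˘ p)       = contradiction (proj₂ (axiom-cuttable p)) (not-cuttable-inv ¬c)
    eliminate₁ r ¬c d (cut c e₁ e₂) = contract c (eliminate₁ r ¬c d e₁) ⌊ e₂ ⌋
    eliminate₁ r ¬c d (replace e)   = eliminate₀ r ¬c d e
    eliminate₁ r ¬c d (replace˘ e)  = ⌊ e ⌋
    eliminate₁ r ¬c d (∧ʳ e₁ e₂)    =
      ⊩.∧ʳ (⊩.replace˘ (eliminate₁ r ¬c d e₁)) (⊩.replace˘ (eliminate₁ r ¬c d e₂))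
    eliminate₁ r ¬c d (∨₁ʳ e)       = ⊩.∨₁ʳ (⊩.replace˘ (eliminate₁ r ¬c d e))
    eliminate₁ r ¬c d (∨₂ʳ e)       = ⊩.∨₂ʳ (⊩.replace˘ (eliminate₁ r ¬c d e))

    explode-on : Rank k γ → ¬ Cuttable γ → γ ⊢[ m ] γ → inv γ ⊢[ n ] inv γ →
                 Rank k′ δ → γ ⊢[ m′ ] δ → inv γ ⊢[ n′ ] inv δ → ψ ⊩ ψ
    explode-on r ¬c d e rδ d′ e′
      with eliminate₁ (rank-inv r) (not-cuttable-inv ¬c) e (invˡ d′) | eliminate₁ r ¬c d e′
    ... | _ , d″ | _ , e″ = cut-admissible₀ rδ d″ e″

    eliminate₀ : Rank k γ → ¬ Cuttable γ → γ ⊢[ m ] γ → inv γ ⊢[ n ] inv γ → ψ ⊩ ψ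
    eliminate₀ r ¬c (ax p)        e = contradiction (proj₁ (axiom-cuttable p)) ¬c
    eliminate₀ r ¬c (ax˘ p)       e = contradiction (proj₁ (axiom-cuttable p)) ¬c
    eliminate₀ r ¬c (cut c d₁ d₂) e =
      explode c (eliminate₁ (rank-inv r) (not-cuttable-inv ¬c) e (invˡ d₁))
                (eliminate₁ (rank-inv r) (not-cuttable-inv ¬c) e (invˡ (exchange d₂)))
    eliminate₀ r ¬c (replace d)   e = eliminate₀ r ¬c d e
    eliminate₀ r ¬c (replace˘ d)  e = eliminate₀ r ¬c d e
    eliminate₀ r@(r₁ ∧ _) ¬c d@(∧ʳ d₁ _) e@(∨₁ʳ e₁) = explode-on r ¬c d e r₁ d₁ e₁
    eliminate₀ r@(r₁ ∧ _) ¬c d@(∧ʳ d₁ _) e@(∨₁ˡ e₁) = explode-on r ¬c d e r₁ d₁ (exchange e₁)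
    eliminate₀ r@(_ ∧ r₂) ¬c d@(∧ʳ _ d₂) e@(∨₂ʳ e₂) = explode-on r ¬c d e r₂ d₂ e₂
    eliminate₀ r@(_ ∧ r₂) ¬c d@(∧ʳ _ d₂) e@(∨₂ˡ e₂) = explode-on r ¬c d e r₂ d₂ (exchange e₂)
    eliminate₀ r@(r₁ ∧ _) ¬c d@(∧ˡ d₁ _) e@(∨₁ʳ e₁) = explode-on r ¬c d e r₁ (exchange d₁) e₁
    eliminate₀ r@(r₁ ∧ _) ¬c d@(∧ˡ d₁ _) e@(∨₁ˡ e₁) = explode-on r ¬c d e r₁ (exchange d₁) (exchange e₁)
    eliminate₀ r@(_ ∧ r₂) ¬c d@(∧ˡ _ d₂) e@(∨₂ʳ e₂) = explode-on r ¬c d e r₂ (exchange d₂) e₂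
    eliminate₀ r@(_ ∧ r₂) ¬c d@(∧ˡ _ d₂) e@(∨₂ˡ e₂) = explode-on r ¬c d e r₂ (exchange d₂) (exchange e₂)
    eliminate₀ r@(r₁ ∨ _) ¬c d@(∨₁ʳ d₁) e@(∧ʳ e₁ _) = explode-on r ¬c d e r₁ d₁ e₁
    eliminate₀ r@(r₁ ∨ _) ¬c d@(∨₁ʳ d₁) e@(∧ˡ e₁ _) = explode-on r ¬c d e r₁ d₁ (exchange e₁)
    eliminate₀ r@(_ ∨ r₂) ¬c d@(∨₂ʳ d₂) e@(∧ʳ _ e₂) = explode-on r ¬c d e r₂ d₂ e₂
    eliminate₀ r@(_ ∨ r₂) ¬c d@(∨₂ʳ d₂) e@(∧ˡ _ e₂) = explode-on r ¬c d e r₂ d₂ (exchange e₂)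
    eliminate₀ r@(r₁ ∨ _) ¬c d@(∨₁ˡ d₁) e@(∧ʳ e₁ _) = explode-on r ¬c d e r₁ (exchange d₁) e₁
    eliminate₀ r@(r₁ ∨ _) ¬c d@(∨₁ˡ d₁) e@(∧ˡ e₁ _) = explode-on r ¬c d e r₁ (exchange d₁) (exchange e₁)
    eliminate₀ r@(_ ∨ r₂) ¬c d@(∨₂ˡ d₂) e@(∧ʳ _ e₂) = explode-on r ¬c d e r₂ (exchange d₂) e₂
    eliminate₀ r@(_ ∨ r₂) ¬c d@(∨₂ˡ d₂) e@(∧ˡ _ e₂) = explode-on r ¬c d e r₂ (exchange d₂) (exchange e₂)
    eliminate₀ r ¬c d (ax p)        = contradiction (proj₁ (axiom-cuttable p)) (not-cuttable-inv ¬c)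
    eliminate₀ r ¬c d (ax˘ p)       = contradiction (proj₁ (axiom-cuttable p)) (not-cuttable-inv ¬c)
    eliminate₀ r ¬c d (cut c e₁ e₂) = explode c (eliminate₁ r ¬c d e₁) (eliminate₁ r ¬c d (exchange e₂))
    eliminate₀ r ¬c d (replace e)   = eliminate₀ r ¬c d e
    eliminate₀ r ¬c d (replace˘ e)  = eliminate₀ r ¬c d e

  cut-elimination : Der A φ ψ → φ ⊩ ψ
  cut-elimination (ax p)         = 0 , ax p
  cut-elimination (hyp x)        = 0 , hyp x
  cut-elimination (swap d)       = ⊩.exchange (cut-elimination d)
  cut-elimination (Der.cut {γ = γ} d e) with cut-elimination d | cut-elimination e
  ... | _ , d′ | _ , e′ = cut-admissible (proj₂ (rank γ)) d′ e′
  cut-elimination (Der.replace d) = ⊩.replace (cut-elimination d)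
  cut-elimination (∧R d e)       = ⊩.∧ʳ (cut-elimination d) (cut-elimination e)
  cut-elimination (∨R₁ d)        = ⊩.∨₁ʳ (cut-elimination d)
  cut-elimination (∨R₂ d)        = ⊩.∨₂ʳ (cut-elimination d)

  -- A derivation whose conclusion is over a subformula-closed Sub containing the cut formulas
  -- mentions only formulas of Sub.
  module _ (Sub : Fm → Set)
    (sub-∧ : ∀ {φ ψ} → Sub (φ ∧ ψ) → Sub φ × Sub ψ)
    (sub-∨ : ∀ {φ ψ} → Sub (φ ∨ ψ) → Sub φ × Sub ψ)
    (cuttable⇒sub : ∀ {γ} → Cuttable γ → Sub γ) where

    record Closed (S : Fm → Fm → Set) : Set where
      field
        exchangeˢ : S φ ψ → S ψ φ
        axiomˢ    : (φ , ψ) ∈ A → S φ ψ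
        hypˢ      : ∀ x → Sub (pos x) → S (pos x) (neg x)
        ∨₁ˢ       : S φ Γ → Sub (φ ∨ ψ) → S (φ ∨ ψ) Γ
        ∨₂ˢ       : S ψ Γ → Sub (φ ∨ ψ) → S (φ ∨ ψ) Γ
        ∧ˢ        : S φ Γ → S ψ Γ → Sub (φ ∧ ψ) → S (φ ∧ ψ) Γ
        cutˢ      : Cuttable γ → S γ φ → S (inv γ) ψ → S φ ψ
        replaceˢ  : S Γ Γ → Sub Δ → S Δ Γ

    analytic⊆closed : ∀ {S} → Closed S → φ ⊢[ n ] ψ → Sub φ → Sub ψ → S φ ψ
    analytic⊆closed {S = S} cl = go
      where
      open Closed cl
      go : φ ⊢[ n ] ψ → Sub φ → Sub ψ → S φ ψ
      go (ax p)       _ _ = axiomˢ p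
      go (ax˘ p)      _ _ = exchangeˢ (axiomˢ p)
      go (hyp x)      a _ = hypˢ x a
      go (hyp˘ x)     _ b = exchangeˢ (hypˢ x b)
      go (cut c d e)  a b =
        cutˢ c (exchangeˢ (go d a (cuttable⇒sub c))) (go e (cuttable⇒sub (cuttable-inv c)) b)
      go (replace d)  a b = exchangeˢ (replaceˢ (go d a a) b)
      go (replace˘ d) a b = replaceˢ (go d b b) a
      go (∧ʳ d e)     a b = exchangeˢ (∧ˢ (exchangeˢ (go d a (proj₁ (sub-∧ b))))
                                         (exchangeˢ (go e a (proj₂ (sub-∧ b)))) b)
      go (∧ˡ d e)     a b = ∧ˢ (go d (proj₁ (sub-∧ a)) b) (go e (proj₂ (sub-∧ a)) b) a
      go (∨₁ʳ d)      a b = exchangeˢ (∨₁ˢ (exchangeˢ (go d a (proj₁ (sub-∨ b)))) b)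
      go (∨₂ʳ d)      a b = exchangeˢ (∨₂ˢ (exchangeˢ (go d a (proj₂ (sub-∨ b)))) b)
      go (∨₁ˡ d)      a b = ∨₁ˢ (go d (proj₁ (sub-∨ a)) b) a
      go (∨₂ˡ d)      a b = ∨₂ˢ (go d (proj₂ (sub-∨ a)) b) a

sub-refl : ∀ φ → φ ∈ sub φ
sub-refl (pos x) = here refl
sub-refl (neg x) = here refl
sub-refl (φ ∧ ψ) = here refl
sub-refl (φ ∨ ψ) = here refl

sub-trans : ∀ χ → φ ∈ sub ψ → ψ ∈ sub χ → φ ∈ sub χ
sub-trans (pos _) φ∈ψ (here refl) = φ∈ψ
sub-trans (neg _) φ∈ψ (here refl) = φ∈ψ
sub-trans (_ ∧ _) φ∈ψ (here refl) = φ∈ψ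
sub-trans (_ ∨ _) φ∈ψ (here refl) = φ∈ψ
sub-trans (χ ∧ χ′) φ∈ψ (there ψ∈χχ′) with ∈-++⁻ (sub χ) ψ∈χχ′
... | inj₁ ψ∈χ  = there (∈-++⁺ˡ (sub-trans χ φ∈ψ ψ∈χ))
... | inj₂ ψ∈χ′ = there (∈-++⁺ʳ (sub χ) (sub-trans χ′ φ∈ψ ψ∈χ′))
sub-trans (χ ∨ χ′) φ∈ψ (there ψ∈χχ′) with ∈-++⁻ (sub χ) ψ∈χχ′
... | inj₁ ψ∈χ  = there (∈-++⁺ˡ (sub-trans χ φ∈ψ ψ∈χ))
... | inj₂ ψ∈χ′ = there (∈-++⁺ʳ (sub χ) (sub-trans χ′ φ∈ψ ψ∈χ′))

sub-inv : ∀ ψ → φ ∈ sub ψ → inv φ ∈ sub (inv ψ)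
sub-inv (pos _) (here refl) = here refl
sub-inv (neg _) (here refl) = here refl
sub-inv (_ ∧ _) (here refl) = here refl
sub-inv (_ ∨ _) (here refl) = here refl
sub-inv (ψ ∧ ψ′) (there m) with ∈-++⁻ (sub ψ) m
... | inj₁ m′ = there (∈-++⁺ˡ (sub-inv ψ m′))
... | inj₂ m′ = there (∈-++⁺ʳ (sub (inv ψ)) (sub-inv ψ′ m′))
sub-inv (ψ ∨ ψ′) (there m) with ∈-++⁻ (sub ψ) m
... | inj₁ m′ = there (∈-++⁺ˡ (sub-inv ψ m′))
... | inj₂ m′ = there (∈-++⁺ʳ (sub (inv ψ)) (sub-inv ψ′ m′))

vars-inv : ∀ φ → vars (inv φ) ≡ vars φ
vars-inv (pos x) = refl
vars-inv (neg x) = refl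
vars-inv (φ ∧ ψ) = cong₂ _++_ (vars-inv φ) (vars-inv ψ)
vars-inv (φ ∨ ψ) = cong₂ _++_ (vars-inv φ) (vars-inv ψ)

pos∈sub⇒var : ∀ φ → pos x ∈ sub φ → x ∈ vars φ
pos∈sub⇒var (pos _) (here refl) = here refl
pos∈sub⇒var (neg _) (here ())
pos∈sub⇒var (φ ∧ ψ) (there m) with ∈-++⁻ (sub φ) m
... | inj₁ m′ = ∈-++⁺ˡ (pos∈sub⇒var φ m′)
... | inj₂ m′ = ∈-++⁺ʳ (vars φ) (pos∈sub⇒var ψ m′)
pos∈sub⇒var (φ ∨ ψ) (there m) with ∈-++⁻ (sub φ) m
... | inj₁ m′ = ∈-++⁺ˡ (pos∈sub⇒var φ m′)
... | inj₂ m′ = ∈-++⁺ʳ (vars φ) (pos∈sub⇒var ψ m′)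

var⇒literal∈sub : ∀ φ → x ∈ vars φ → pos x ∈ sub φ ⊎ neg x ∈ sub φ
var⇒literal∈sub (pos _) (here refl) = inj₁ (here refl)
var⇒literal∈sub (neg _) (here refl) = inj₂ (here refl)
var⇒literal∈sub (φ ∧ ψ) m with ∈-++⁻ (vars φ) m
... | inj₁ m′ = Sum.map (there ∘ ∈-++⁺ˡ) (there ∘ ∈-++⁺ˡ) (var⇒literal∈sub φ m′)
... | inj₂ m′ = Sum.map (there ∘ ∈-++⁺ʳ (sub φ)) (there ∘ ∈-++⁺ʳ (sub φ)) (var⇒literal∈sub ψ m′)
var⇒literal∈sub (φ ∨ ψ) m with ∈-++⁻ (vars φ) m
... | inj₁ m′ = Sum.map (there ∘ ∈-++⁺ˡ) (there ∘ ∈-++⁺ˡ) (var⇒literal∈sub φ m′)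
... | inj₂ m′ = Sum.map (there ∘ ∈-++⁺ʳ (sub φ)) (there ∘ ∈-++⁺ʳ (sub φ)) (var⇒literal∈sub ψ m′)

ConjOf : Fm → Fm → Fm → Set
ConjOf φ ψ χ = χ ≡ φ ∧ ψ ⊎ χ ≡ ψ ∧ φ

DisjOf : Fm → Fm → Set
DisjOf φ χ = ∃[ ψ ] (χ ≡ φ ∨ ψ ⊎ χ ≡ ψ ∨ φ)

infix 4 _≈_ _∈≈_

_≈_ : Seq → Seq → Set
q ≈ r = q ≡ r ⊎ q ≡ Product.swap r

≈-sym : q ≈ r → r ≈ q
≈-sym (inj₁ refl) = inj₁ refl
≈-sym (inj₂ refl) = inj₂ refl

≈-trans : q ≈ r → r ≈ t → q ≈ t
≈-trans (inj₁ refl) r≈t         = r≈t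
≈-trans (inj₂ refl) (inj₁ refl) = inj₂ refl
≈-trans (inj₂ refl) (inj₂ refl) = inj₁ refl

_∈≈_ : Seq → List Seq → Set
q ∈≈ l = Any (q ≈_) l

∈⇒∈≈ : q ∈ qs → q ∈≈ qs
∈⇒∈≈ = Any.map inj₁

∈≈-resp-≈ : q ≈ r → r ∈≈ qs → q ∈≈ qs
∈≈-resp-≈ q≈r = Any.map (≈-trans q≈r)

∈≈-swap : (φ , ψ) ∈≈ qs → (ψ , φ) ∈≈ qs
∈≈-swap = ∈≈-resp-≈ (inj₂ refl)

Unique≈ : List Seq → Set
Unique≈ = AllPairs (λ q r → ¬ q ≈ r)

module _ {X : Set} where

  remove : (ys : List X) {x : X} → x ∈ ys → List X
  remove (_ ∷ ys) (here _)  = ys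
  remove (y ∷ ys) (there p) = y ∷ remove ys p

  length-remove : (ys : List X) {x : X} (p : x ∈ ys) → length ys ≡ suc (length (remove ys p))
  length-remove (_ ∷ _)  (here _)  = refl
  length-remove (_ ∷ ys) (there p) = cong suc (length-remove ys p)

  ∈-remove : (ys : List X) {x y : X} (p : x ∈ ys) → y ∈ ys → y ≢ x → y ∈ remove ys p
  ∈-remove (_ ∷ _)  (here refl) (here refl) y≢x = contradiction refl y≢x
  ∈-remove (_ ∷ _)  (here refl) (there q)   _   = q
  ∈-remove (_ ∷ _)  (there p)   (here refl) _   = here refl
  ∈-remove (_ ∷ ys) (there p)   (there q)   y≢x = there (∈-remove ys p q y≢x)

  unique⊆⇒length≤ : {xs ys : List X} → Unique xs → xs ⊆ ys → length xs ≤ length ys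
  unique⊆⇒length≤ []                     _      = z≤n
  unique⊆⇒length≤ {ys = ys} (x∉xs ∷ u) xs⊆ys =
    subst (_ ≤_) (sym (length-remove ys (xs⊆ys (here refl))))
      (s≤s (unique⊆⇒length≤ u λ m →
        ∈-remove ys (xs⊆ys (here refl)) (xs⊆ys (there m)) (≢-sym (All.lookup x∉xs m))))

fuel-step : {X : Set} (new rest P : List X) {b n : ℕ} →
            suc (length rest) + b < length P + suc n → length (new ++ rest) + b < length (new ++ P) + n
fuel-step new rest P {b} {n} fuel
  rewrite length-++ new {rest} | length-++ new {P}
        | +-assoc (length new) (length rest) b | +-assoc (length new) (length P) n =
  +-monoʳ-< (length new) (s≤s⁻¹ (subst (suc (length rest) + b <_) (+-suc (length P) n) fuel))

reflects-map : {P Q : Set} {b : Bool} → (P → Q) → (Q → P) → Reflects P b → Reflects Q b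
reflects-map f g (ofʸ p)  = ofʸ (f p)
reflects-map f g (ofⁿ ¬p) = ofⁿ (¬p ∘ g)

eqF-reflects : ∀ φ ψ → Reflects (φ ≡ ψ) (eqF φ ψ)
eqF-reflects (pos x) (pos y) =
  reflects-map (cong pos) (λ { refl → refl }) (fromEquivalence (≡ᵇ⇒≡ x y) (≡⇒≡ᵇ x y))
eqF-reflects (neg x) (neg y) =
  reflects-map (cong neg) (λ { refl → refl }) (fromEquivalence (≡ᵇ⇒≡ x y) (≡⇒≡ᵇ x y))
eqF-reflects (φ ∧ ψ) (φ′ ∧ ψ′) =
  reflects-map (uncurry (cong₂ _∧_)) (λ { refl → refl , refl })
    (eqF-reflects φ φ′ ×-reflects eqF-reflects ψ ψ′)
eqF-reflects (φ ∨ ψ) (φ′ ∨ ψ′) =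
  reflects-map (uncurry (cong₂ _∨_)) (λ { refl → refl , refl })
    (eqF-reflects φ φ′ ×-reflects eqF-reflects ψ ψ′)
eqF-reflects (pos _) (neg _) = ofⁿ λ ()
eqF-reflects (pos _) (_ ∧ _) = ofⁿ λ ()
eqF-reflects (pos _) (_ ∨ _) = ofⁿ λ ()
eqF-reflects (neg _) (pos _) = ofⁿ λ ()
eqF-reflects (neg _) (_ ∧ _) = ofⁿ λ ()
eqF-reflects (neg _) (_ ∨ _) = ofⁿ λ ()
eqF-reflects (_ ∧ _) (pos _) = ofⁿ λ ()
eqF-reflects (_ ∧ _) (neg _) = ofⁿ λ ()
eqF-reflects (_ ∧ _) (_ ∨ _) = ofⁿ λ ()
eqF-reflects (_ ∨ _) (pos _) = ofⁿ λ ()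
eqF-reflects (_ ∨ _) (neg _) = ofⁿ λ ()
eqF-reflects (_ ∨ _) (_ ∧ _) = ofⁿ λ ()

≡⇒eqF : φ ≡ ψ → eqF φ ψ ≡ true
≡⇒eqF {φ} {ψ} φ≡ψ with eqF φ ψ | eqF-reflects φ ψ
... | true  | _       = refl
... | false | ofⁿ φ≢ψ = contradiction φ≡ψ φ≢ψ

eqS-reflects : ∀ q r → Reflects (q ≈ r) (eqS q r)
eqS-reflects (φ , ψ) (φ′ , ψ′) =
  reflects-map (Sum.map (uncurry (cong₂ _,_)) (uncurry (cong₂ _,_))) (Sum.map ,-injective ,-injective)
    (  (eqF-reflects φ φ′ ×-reflects eqF-reflects ψ ψ′)
    ⊎-reflects (eqF-reflects φ ψ′ ×-reflects eqF-reflects ψ φ′))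

anyB-reflects : {X : Set} {P : X → Set} {p : X → Bool} →
                (∀ x → Reflects (P x) (p x)) → ∀ xs → Reflects (Any P xs) (anyB p xs)
anyB-reflects P? []       = ofⁿ λ ()
anyB-reflects P? (x ∷ xs) = reflects-map Any.fromSum Any.toSum (P? x ⊎-reflects anyB-reflects P? xs)

memF-reflects : ∀ φ l → Reflects (φ ∈ l) (memF φ l)
memF-reflects φ = anyB-reflects (eqF-reflects φ)

memS-reflects : ∀ q l → Reflects (q ∈≈ l) (memS q l)
memS-reflects q = anyB-reflects (eqS-reflects q)

∈-filterB⁻ : {X : Set} {P : X → Set} {p : X → Bool} {x : X} → (∀ y → Reflects (P y) (p y)) →
             ∀ xs → x ∈ filterB p xs → x ∈ xs × P x
∈-filterB⁻ {p = p} P? (y ∷ xs) m with p y | P? y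
∈-filterB⁻ P? (y ∷ xs) (here refl) | true  | ofʸ py = here refl , py
∈-filterB⁻ P? (y ∷ xs) (there m)   | true  | _      = Product.map₁ there (∈-filterB⁻ P? xs m)
∈-filterB⁻ P? (y ∷ xs) m           | false | _      = Product.map₁ there (∈-filterB⁻ P? xs m)

∈-filterB⁺ : {X : Set} {P : X → Set} {p : X → Bool} {x : X} → (∀ y → Reflects (P y) (p y)) →
             ∀ xs → x ∈ xs → P x → x ∈ filterB p xs
∈-filterB⁺ {p = p} P? (y ∷ xs) (here refl) px with p y | P? y
... | true  | _       = here refl
... | false | ofⁿ ¬px = contradiction px ¬px
∈-filterB⁺ {p = p} P? (y ∷ xs) (there m) px with p y
... | true  = there (∈-filterB⁺ P? xs m px)
... | false = ∈-filterB⁺ P? xs m px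

filterB-cong : {X : Set} {p p′ : X → Bool} → (∀ x → p x ≡ p′ x) → ∀ xs → filterB p xs ≡ filterB p′ xs
filterB-cong p≗p′ []       = refl
filterB-cong p≗p′ (x ∷ xs) rewrite p≗p′ x | filterB-cong p≗p′ xs = refl

∈-insertF⁻ : φ ∈ insertF ψ ls → φ ≡ ψ ⊎ φ ∈ ls
∈-insertF⁻ {ψ = ψ} {ls = ls} m with memF ψ ls
... | true  = inj₂ m
∈-insertF⁻ (here refl) | false = inj₁ refl
∈-insertF⁻ (there m)   | false = inj₂ m

∈-insertF⁺ : φ ≡ ψ ⊎ φ ∈ ls → φ ∈ insertF ψ ls
∈-insertF⁺ {ψ = ψ} {ls = ls} h with memF ψ ls | memF-reflects ψ ls
∈-insertF⁺ (inj₁ refl) | true  | ofʸ ψ∈ls = ψ∈ls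
∈-insertF⁺ (inj₂ φ∈ls) | true  | _        = φ∈ls
∈-insertF⁺ (inj₁ refl) | false | _        = here refl
∈-insertF⁺ (inj₂ φ∈ls) | false | _        = there φ∈ls

module Correctness (s : Seq) (A : List Seq) where

  open Procedure s A

  subformulas : Fm → List Fm
  subformulas φ = sub φ ++ sub (inv φ)

  ∈-SF⁺ : φ ∈ inputFms → ψ ∈ sub φ ⊎ ψ ∈ sub (inv φ) → ψ ∈ SF
  ∈-SF⁺ {φ} φ∈ m = ∈-concatMap⁺ subformulas (lose φ∈ (Sum.[ ∈-++⁺ˡ , ∈-++⁺ʳ (sub φ) ]′ m))

  ∈-SF⁻ : ψ ∈ SF → ∃[ φ ] (φ ∈ inputFms × (ψ ∈ sub φ ⊎ ψ ∈ sub (inv φ)))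
  ∈-SF⁻ m with find (∈-concatMap⁻ subformulas {xs = inputFms} m)
  ... | φ , φ∈ , m′ = φ , φ∈ , ∈-++⁻ (sub φ) m′

  SF-closed : φ ∈ sub ψ → ψ ∈ SF → φ ∈ SF
  SF-closed φ∈ψ ψ∈SF with ∈-SF⁻ ψ∈SF
  ... | χ , χ∈ , inj₁ ψ∈χ  = ∈-SF⁺ χ∈ (inj₁ (sub-trans χ φ∈ψ ψ∈χ))
  ... | χ , χ∈ , inj₂ ψ∈χ′ = ∈-SF⁺ χ∈ (inj₂ (sub-trans (inv χ) φ∈ψ ψ∈χ′))

  SF-∧ : (φ ∧ ψ) ∈ SF → φ ∈ SF × ψ ∈ SF
  SF-∧ {φ} m = SF-closed (there (∈-++⁺ˡ (sub-refl φ))) m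
             , SF-closed (there (∈-++⁺ʳ (sub φ) (sub-refl _))) m

  SF-∨ : (φ ∨ ψ) ∈ SF → φ ∈ SF × ψ ∈ SF
  SF-∨ {φ} m = SF-closed (there (∈-++⁺ˡ (sub-refl φ))) m
             , SF-closed (there (∈-++⁺ʳ (sub φ) (sub-refl _))) m

  axiom∈inputFms : (φ , ψ) ∈ A → φ ∈ inputFms × ψ ∈ inputFms
  axiom∈inputFms p = there (there (∈-concatMap⁺ _ (lose p (here refl))))
                   , there (there (∈-concatMap⁺ _ (lose p (there (here refl)))))

  s∈SF : proj₁ s ∈ SF × proj₂ s ∈ SF
  s∈SF = ∈-SF⁺ (here refl) (inj₁ (sub-refl _)) , ∈-SF⁺ (there (here refl)) (inj₁ (sub-refl _))

  axiom∈AF : (φ , ψ) ∈ A → φ ∈ AF × ψ ∈ AF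
  axiom∈AF p = ∈-concatMap⁺ _ (lose p (here refl)) , ∈-concatMap⁺ _ (lose p (there (here refl)))

  axiomFormulas : Seq → List Fm
  axiomFormulas (φ , ψ) = φ ∷ ψ ∷ inv φ ∷ inv ψ ∷ []

  AF-inv : γ ∈ AF → inv γ ∈ AF
  AF-inv m with find (∈-concatMap⁻ axiomFormulas {xs = A} m)
  ... | _ , p , here refl =
    ∈-concatMap⁺ _ (lose p (there (there (here refl))))
  ... | _ , p , there (here refl) =
    ∈-concatMap⁺ _ (lose p (there (there (there (here refl)))))
  ... | (φ , _) , p , there (there (here refl)) =
    ∈-concatMap⁺ _ (lose p (here (inv-involutive φ)))
  ... | (_ , ψ) , p , there (there (there (here refl))) =
    ∈-concatMap⁺ _ (lose p (there (here (inv-involutive ψ))))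

  AF⊆SF : γ ∈ AF → γ ∈ SF
  AF⊆SF m with find (∈-concatMap⁻ axiomFormulas {xs = A} m)
  ... | _ , p , here refl                         = ∈-SF⁺ (proj₁ (axiom∈inputFms p)) (inj₁ (sub-refl _))
  ... | _ , p , there (here refl)                 = ∈-SF⁺ (proj₂ (axiom∈inputFms p)) (inj₁ (sub-refl _))
  ... | _ , p , there (there (here refl))         = ∈-SF⁺ (proj₁ (axiom∈inputFms p)) (inj₂ (sub-refl _))
  ... | _ , p , there (there (there (here refl))) = ∈-SF⁺ (proj₂ (axiom∈inputFms p)) (inj₂ (sub-refl _))

  var⇒literals∈SF : x ∈ X → pos x ∈ SF × neg x ∈ SF
  var⇒literals∈SF m with find (∈-concatMap⁻ vars {xs = inputFms} m)
  ... | φ , φ∈ , x∈φ with var⇒literal∈sub φ x∈φ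
  ...   | inj₁ p = ∈-SF⁺ φ∈ (inj₁ p) , ∈-SF⁺ φ∈ (inj₂ (sub-inv φ p))
  ...   | inj₂ n = ∈-SF⁺ φ∈ (inj₂ (sub-inv φ n)) , ∈-SF⁺ φ∈ (inj₁ n)

  pos∈SF⇒var : pos x ∈ SF → x ∈ X
  pos∈SF⇒var m with ∈-SF⁻ m
  ... | φ , φ∈ , inj₁ p = ∈-concatMap⁺ vars (lose φ∈ (pos∈sub⇒var φ p))
  ... | φ , φ∈ , inj₂ p = ∈-concatMap⁺ vars (lose φ∈ (subst (_ ∈_) (vars-inv φ) (pos∈sub⇒var (inv φ) p)))

  recordCut : Fm → Fm → (Fm → List Fm) → Fm → List Fm
  recordCut a b f = if memF a AF then addCut (inv a) b f else f

  ∈-recordCut⁻ : ∀ {a b f} → φ ∈ recordCut a b f γ → (a ∈ AF × γ ≡ inv a × φ ≡ b) ⊎ φ ∈ f γ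
  ∈-recordCut⁻ {γ = γ} {a = a} m with memF a AF | memF-reflects a AF
  ... | false | _      = inj₂ m
  ... | true  | ofʸ a∈ with eqF γ (inv a) | eqF-reflects γ (inv a)
  ...   | true  | ofʸ refl = Sum.map₁ (λ φ≡b → a∈ , refl , φ≡b) (∈-insertF⁻ m)
  ...   | false | _        = inj₂ m

  ∈-recordCut⁺ : ∀ {a b f} → (a ∈ AF × γ ≡ inv a × φ ≡ b) ⊎ φ ∈ f γ → φ ∈ recordCut a b f γ
  ∈-recordCut⁺ {γ = γ} {a = a} h with memF a AF | memF-reflects a AF
  ... | false | ofⁿ a∉ = Sum.[ (λ (a∈ , _) → contradiction a∈ a∉) , id ]′ h
  ... | true  | _ with eqF γ (inv a) | eqF-reflects γ (inv a)
  ...   | true  | ofʸ refl = ∈-insertF⁺ (Sum.map₁ (proj₂ ∘ proj₂) h)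
  ...   | false | ofⁿ γ≢  = Sum.[ (λ (_ , γ≡ , _) → contradiction γ≡ γ≢) , id ]′ h

  ∈-addAnd⁻ : ∀ {k₁ k₂ g} → φ ∈ addAnd k₁ k₂ χ g Γ ψ → (Γ ≡ k₁ × ψ ≡ k₂ × φ ≡ χ) ⊎ φ ∈ g Γ ψ
  ∈-addAnd⁻ {Γ = Γ} {ψ = ψ} {k₁ = k₁} {k₂ = k₂} m
    with eqF Γ k₁ ∧ᵇ eqF ψ k₂ | eqF-reflects Γ k₁ ×-reflects eqF-reflects ψ k₂
  ... | true  | ofʸ (refl , refl) = Sum.map₁ (λ φ≡χ → refl , refl , φ≡χ) (∈-insertF⁻ m)
  ... | false | _                 = inj₂ m

  ∈-addAnd⁺ : ∀ {k₁ k₂ g} → (Γ ≡ k₁ × ψ ≡ k₂ × φ ≡ χ) ⊎ φ ∈ g Γ ψ → φ ∈ addAnd k₁ k₂ χ g Γ ψ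
  ∈-addAnd⁺ {Γ = Γ} {ψ = ψ} {k₁ = k₁} {k₂ = k₂} h
    with eqF Γ k₁ ∧ᵇ eqF ψ k₂ | eqF-reflects Γ k₁ ×-reflects eqF-reflects ψ k₂
  ... | true  | ofʸ _ = ∈-insertF⁺ (Sum.map₁ (proj₂ ∘ proj₂) h)
  ... | false | ofⁿ ≢ = Sum.[ (λ (Γ≡ , ψ≡ , _) → contradiction (Γ≡ , ψ≡) ≢) , id ]′ h

  -- conjStep and isDisjOf replicate the local helpers of conjUpd and disj, which cannot be named.
  conjStep : Fm → Fm → (Fm → Fm → List Fm) → Fm → Fm → Fm → List Fm
  conjStep a b h (l ∧ r) = (if eqF r a then addAnd b l (l ∧ r) else id)
                             ((if eqF l a then addAnd b r (l ∧ r) else id) h)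
  conjStep a b h _       = h

  conjUpd≡ : ∀ a b g → conjUpd a b g ≡ foldl (conjStep a b) g SF
  conjUpd≡ a b g =
    foldl-cong (λ { h (pos _) → refl ; h (neg _) → refl ; h (_ ∧ _) → refl ; h (_ ∨ _) → refl }) g SF

  ∈-addAndIf⁻ : ∀ {a b c d g} → φ ∈ (if eqF c a then addAnd b d χ else id) g Γ ψ →
                (c ≡ a × Γ ≡ b × ψ ≡ d × φ ≡ χ) ⊎ φ ∈ g Γ ψ
  ∈-addAndIf⁻ {a = a} {c = c} {g = g} m with eqF c a | eqF-reflects c a
  ... | true  | ofʸ refl = Sum.map₁ (refl ,_) (∈-addAnd⁻ {g = g} m)
  ... | false | _        = inj₂ m

  ∈-addAndIf⁺ : ∀ {a b c d g} → (c ≡ a × Γ ≡ b × ψ ≡ d × φ ≡ χ) ⊎ φ ∈ g Γ ψ →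
                φ ∈ (if eqF c a then addAnd b d χ else id) g Γ ψ
  ∈-addAndIf⁺ {a = a} {c = c} {g = g} h with eqF c a | eqF-reflects c a
  ... | true  | _        = ∈-addAnd⁺ {g = g} (Sum.map₁ proj₂ h)
  ... | false | ofⁿ c≢a  = Sum.[ (λ (c≡a , _) → contradiction c≡a c≢a) , id ]′ h

  ∈-conjStep⁻ : ∀ {a b h} z → φ ∈ conjStep a b h z Γ ψ → φ ∈ h Γ ψ ⊎ (Γ ≡ b × φ ≡ z × ConjOf a ψ z)
  ∈-conjStep⁻ (pos _) m = inj₁ m
  ∈-conjStep⁻ (neg _) m = inj₁ m
  ∈-conjStep⁻ (_ ∨ _) m = inj₁ m
  ∈-conjStep⁻ (l ∧ r) m with ∈-addAndIf⁻ {c = r} m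
  ... | inj₁ (refl , refl , refl , refl) = inj₂ (refl , refl , inj₂ refl)
  ... | inj₂ m′ with ∈-addAndIf⁻ {c = l} m′
  ...   | inj₁ (refl , refl , refl , refl) = inj₂ (refl , refl , inj₁ refl)
  ...   | inj₂ m″                          = inj₁ m″

  ∈-conjStep⁺ : ∀ {a b h} z → φ ∈ h Γ ψ ⊎ (Γ ≡ b × φ ≡ z × ConjOf a ψ z) → φ ∈ conjStep a b h z Γ ψ
  ∈-conjStep⁺ (pos _) (inj₁ m)                      = m
  ∈-conjStep⁺ (pos _) (inj₂ (_ , _ , inj₁ ()))
  ∈-conjStep⁺ (pos _) (inj₂ (_ , _ , inj₂ ()))
  ∈-conjStep⁺ (neg _) (inj₁ m)                      = m
  ∈-conjStep⁺ (neg _) (inj₂ (_ , _ , inj₁ ()))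
  ∈-conjStep⁺ (neg _) (inj₂ (_ , _ , inj₂ ()))
  ∈-conjStep⁺ (_ ∨ _) (inj₁ m)                      = m
  ∈-conjStep⁺ (_ ∨ _) (inj₂ (_ , _ , inj₁ ()))
  ∈-conjStep⁺ (_ ∨ _) (inj₂ (_ , _ , inj₂ ()))
  ∈-conjStep⁺ (l ∧ r) (inj₁ m) = ∈-addAndIf⁺ {c = r} (inj₂ (∈-addAndIf⁺ {c = l} (inj₂ m)))
  ∈-conjStep⁺ (l ∧ r) (inj₂ (refl , refl , inj₁ refl)) =
    ∈-addAndIf⁺ {c = r} (inj₂ (∈-addAndIf⁺ {c = l} (inj₁ (refl , refl , refl , refl))))
  ∈-conjStep⁺ (l ∧ r) (inj₂ (refl , refl , inj₂ refl)) =
    ∈-addAndIf⁺ {c = r} (inj₁ (refl , refl , refl , refl))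

  ∈-conjFold⁻ : ∀ {a b} zs g → φ ∈ foldl (conjStep a b) g zs Γ ψ →
                φ ∈ g Γ ψ ⊎ (Γ ≡ b × φ ∈ zs × ConjOf a ψ φ)
  ∈-conjFold⁻ []       g m = inj₁ m
  ∈-conjFold⁻ (z ∷ zs) g m with ∈-conjFold⁻ zs _ m
  ... | inj₂ (Γ≡b , φ∈ , c) = inj₂ (Γ≡b , there φ∈ , c)
  ... | inj₁ m′ with ∈-conjStep⁻ z m′
  ...   | inj₁ m″                = inj₁ m″
  ...   | inj₂ (Γ≡b , refl , c) = inj₂ (Γ≡b , here refl , c)

  ∈-conjFold⁺ : ∀ {a b} zs g → φ ∈ g Γ ψ ⊎ (Γ ≡ b × φ ∈ zs × ConjOf a ψ φ) →
                φ ∈ foldl (conjStep a b) g zs Γ ψ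
  ∈-conjFold⁺ []       g (inj₁ m)                      = m
  ∈-conjFold⁺ []       g (inj₂ (_ , () , _))
  ∈-conjFold⁺ (z ∷ zs) g (inj₁ m) = ∈-conjFold⁺ zs _ (inj₁ (∈-conjStep⁺ z (inj₁ m)))
  ∈-conjFold⁺ (z ∷ zs) g (inj₂ (Γ≡b , here refl , c)) =
    ∈-conjFold⁺ zs _ (inj₁ (∈-conjStep⁺ z (inj₂ (Γ≡b , refl , c))))
  ∈-conjFold⁺ (z ∷ zs) g (inj₂ (Γ≡b , there φ∈ , c)) = ∈-conjFold⁺ zs _ (inj₂ (Γ≡b , φ∈ , c))

  ∈-conjUpd⁻ : ∀ {a b g} → φ ∈ conjUpd a b g Γ ψ → φ ∈ g Γ ψ ⊎ (Γ ≡ b × φ ∈ SF × ConjOf a ψ φ)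
  ∈-conjUpd⁻ {a = a} {b} {g} m = ∈-conjFold⁻ SF g (subst (λ t → _ ∈ t _ _) (conjUpd≡ a b g) m)

  ∈-conjUpd⁺ : ∀ {a b g} → φ ∈ g Γ ψ ⊎ (Γ ≡ b × φ ∈ SF × ConjOf a ψ φ) → φ ∈ conjUpd a b g Γ ψ
  ∈-conjUpd⁺ {a = a} {b} {g} h = subst (λ t → _ ∈ t _ _) (sym (conjUpd≡ a b g)) (∈-conjFold⁺ SF g h)

  isDisjOf : Fm → Fm → Bool
  isDisjOf a (l ∨ r) = eqF l a ∨ᵇ eqF r a
  isDisjOf a _       = false

  isDisjOf-reflects : ∀ a χ → Reflects (DisjOf a χ) (isDisjOf a χ)
  isDisjOf-reflects a (l ∨ r) =
    reflects-map (Sum.[ (λ { refl → r , inj₁ refl }) , (λ { refl → l , inj₂ refl }) ]′)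
                 (λ { (_ , inj₁ refl) → inj₁ refl ; (_ , inj₂ refl) → inj₂ refl })
                 (eqF-reflects l a ⊎-reflects eqF-reflects r a)
  isDisjOf-reflects a (pos _) = ofⁿ λ { (_ , inj₁ ()) ; (_ , inj₂ ()) }
  isDisjOf-reflects a (neg _) = ofⁿ λ { (_ , inj₁ ()) ; (_ , inj₂ ()) }
  isDisjOf-reflects a (_ ∧ _) = ofⁿ λ { (_ , inj₁ ()) ; (_ , inj₂ ()) }

  disj≡ : ∀ a → disj a ≡ filterB (isDisjOf a) SF
  disj≡ a = filterB-cong (λ { (pos _) → refl ; (neg _) → refl ; (_ ∧ _) → refl ; (_ ∨ _) → refl }) SF

  ∈-disj⁻ : ∀ {a} → χ ∈ disj a → χ ∈ SF × DisjOf a χ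
  ∈-disj⁻ {a = a} m = ∈-filterB⁻ (isDisjOf-reflects a) SF (subst (_ ∈_) (disj≡ a) m)

  ∈-disj⁺ : ∀ {a} → χ ∈ SF → DisjOf a χ → χ ∈ disj a
  ∈-disj⁺ {a = a} χ∈SF d = subst (_ ∈_) (sym (disj≡ a)) (∈-filterB⁺ (isDisjOf-reflects a) SF χ∈SF d)

  record Insertion (P W qs : List Seq) (PW : List Seq × List Seq) : Set where
    field
      new    : List Seq
      result : PW ≡ (new ++ P , new ++ W)
      new⊆qs : new ⊆ qs
      qs⊆≈   : q ∈ qs → q ∈≈ new ++ P
      unique : Unique≈ P → Unique≈ (new ++ P)

  insertion : ∀ P W qs → Insertion P W qs (foldl addNew (P , W) qs)
  insertion P W [] = record { new = [] ; result = refl ; new⊆qs = λ () ; qs⊆≈ = λ () ; unique = id }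
  insertion P W (q ∷ qs) with memS q P | memS-reflects q P
  ... | true  | ofʸ q∈≈P = record
    { new    = new
    ; result = result
    ; new⊆qs = there ∘ new⊆qs
    ; qs⊆≈   = λ { (here refl) → Any-resp-⊆ (xs⊆ys++xs P new) q∈≈P ; (there m) → qs⊆≈ m }
    ; unique = unique
    }
    where open Insertion (insertion P W qs)
  ... | false | ofⁿ q∉≈P = record
    { new    = new ++ [ q ]
    ; result = trans result (cong₂ _,_ (reassoc P) (reassoc W))
    ; new⊆qs = λ m → Sum.[ there ∘ new⊆qs , (λ { (here refl) → here refl ; (there ()) }) ]′ (∈-++⁻ new m)
    ; qs⊆≈   = λ { (here refl) → ∈⇒∈≈ (∈-++⁺ˡ (∈-++⁺ʳ new (here refl)))
                 ; (there m)   → subst (_ ∈≈_) (reassoc P) (qs⊆≈ m) }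
    ; unique = λ u → subst Unique≈ (reassoc P) (unique (¬Any⇒All¬ P q∉≈P ∷ u))
    }
    where
    open Insertion (insertion (q ∷ P) (q ∷ W) qs)
    reassoc : ∀ R → new ++ q ∷ R ≡ (new ++ [ q ]) ++ R
    reassoc R = sym (++-assoc new [ q ] R)

  initList : List Seq
  initList = A ++ map (λ x → pos x , neg x) X

  dedupS≡ : ∀ P W qs →
            proj₁ (foldl addNew (P , W) qs) ≡ foldl (λ acc q → if memS q acc then acc else q ∷ acc) P qs
  dedupS≡ P W []       = refl
  dedupS≡ P W (q ∷ qs) with memS q P
  ... | true  = dedupS≡ P W qs
  ... | false = dedupS≡ (q ∷ P) (q ∷ W) qs

  module Initial = Insertion (insertion [] [] initList)

  initSet≡ : initSet ≡ Initial.new ++ []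
  initSet≡ = trans (sym (dedupS≡ [] [] initList)) (cong proj₁ Initial.result)

  initSet⊆initList : initSet ⊆ initList
  initSet⊆initList m = Initial.new⊆qs (subst (_ ∈_) (trans initSet≡ (++-identityʳ Initial.new)) m)

  initList⊆≈initSet : q ∈ initList → q ∈≈ initSet
  initList⊆≈initSet m = subst (_ ∈≈_) (sym initSet≡) (Initial.qs⊆≈ m)

  initSet-unique : Unique≈ initSet
  initSet-unique = subst Unique≈ (sym initSet≡) (Initial.unique [])

  Sound : Seq → Set
  Sound (φ , ψ) = Der A φ ψ × φ ∈ SF × ψ ∈ SF

  sound-swap : Sound (φ , ψ) → Sound (ψ , φ)
  sound-swap (d , φ∈SF , ψ∈SF) = swap d , ψ∈SF , φ∈SF

  ∈≈-sound : (∀ {r} → r ∈ qs → Sound r) → q ∈≈ qs → Sound q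
  ∈≈-sound qs-sound m with find m
  ... | _ , r∈ , inj₁ refl = qs-sound r∈
  ... | _ , r∈ , inj₂ refl = sound-swap (qs-sound r∈)

  initSet-sound : q ∈ initSet → Sound q
  initSet-sound m with ∈-++⁻ A (initSet⊆initList m)
  ... | inj₁ p = ax p , AF⊆SF (proj₁ (axiom∈AF p)) , AF⊆SF (proj₂ (axiom∈AF p))
  ... | inj₂ h with ∈-map⁻ (λ x → pos x , neg x) h
  ...   | x , x∈X , refl = hyp x , var⇒literals∈SF x∈X

  data Consequence (D : List Seq) : Fm → Fm → Set where
    by-∨₁      : (φ , Γ) ∈≈ D → (φ ∨ ψ) ∈ SF → Consequence D (φ ∨ ψ) Γ
    by-∨₂      : (ψ , Γ) ∈≈ D → (φ ∨ ψ) ∈ SF → Consequence D (φ ∨ ψ) Γ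
    by-∧       : (φ , Γ) ∈≈ D → (ψ , Γ) ∈≈ D → (φ ∧ ψ) ∈ SF → Consequence D (φ ∧ ψ) Γ
    by-cut     : γ ∈ AF → (γ , φ) ∈≈ D → (inv γ , ψ) ∈≈ D → Consequence D φ ψ
    by-replace : (Γ , Γ) ∈≈ D → Δ ∈ SF → Consequence D Δ Γ

  consequence-sound : ∀ {D} → (∀ {q} → q ∈≈ D → Sound q) → Consequence D φ ψ → Sound (φ , ψ)
  consequence-sound D-sound (by-∨₁ p φ∨ψ∈SF) with D-sound p
  ... | d , _ , Γ∈SF = swap (∨R₁ (swap d)) , φ∨ψ∈SF , Γ∈SF
  consequence-sound D-sound (by-∨₂ p φ∨ψ∈SF) with D-sound p
  ... | d , _ , Γ∈SF = swap (∨R₂ (swap d)) , φ∨ψ∈SF , Γ∈SF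
  consequence-sound D-sound (by-∧ p p′ φ∧ψ∈SF) with D-sound p | D-sound p′
  ... | d , _ , Γ∈SF | d′ , _ = swap (∧R (swap d) (swap d′)) , φ∧ψ∈SF , Γ∈SF
  consequence-sound D-sound (by-cut _ p p′) with D-sound p | D-sound p′
  ... | d , _ , φ∈SF | d′ , _ , ψ∈SF = Der.cut (swap d) d′ , φ∈SF , ψ∈SF
  consequence-sound D-sound (by-replace p Δ∈SF) with D-sound p
  ... | d , Γ∈SF , _ = swap (Der.replace d) , Δ∈SF , Γ∈SF

  no-consequence : ¬ Consequence [] φ ψ
  no-consequence (by-∨₁ () _)
  no-consequence (by-∨₂ () _)
  no-consequence (by-∧ () _ _)
  no-consequence (by-cut _ () _)
  no-consequence (by-replace () _)

  -- D is the list of the sequents popped so far.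
  record Invariant (σ : State) (D : List Seq) : Set where
    field
      P-sound      : q ∈ P σ → Sound q
      P-unique     : Unique≈ (P σ)
      initSet⊆P    : initSet ⊆ P σ
      W⊆P          : W σ ⊆ P σ
      D⊆P          : D ⊆ P σ
      P⊆D∪W        : q ∈ P σ → q ∈ D ⊎ q ∈ W σ
      s∉D          : q ∈ D → ¬ q ≈ s
      saturated    : Consequence D φ ψ → (φ , ψ) ∈≈ P σ
      cut-sound    : φ ∈ pcut σ γ → ∃[ δ ] (γ ≡ inv δ × δ ∈ AF × (δ , φ) ∈≈ D)
      cut-complete : γ ∈ AF → (γ , φ) ∈≈ D → φ ∈ pcut σ (inv γ)
      and-sound    : χ ∈ pand σ Γ ψ → χ ∈ SF × ∃[ φ ] (ConjOf φ ψ χ × (φ , Γ) ∈≈ D)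
      and-complete : (φ , Γ) ∈≈ D → χ ∈ SF → ConjOf φ ψ χ → χ ∈ pand σ Γ ψ

  initial-invariant : Invariant initState []
  initial-invariant = record
    { P-sound      = initSet-sound
    ; P-unique     = initSet-unique
    ; initSet⊆P    = id
    ; W⊆P          = id
    ; D⊆P          = λ ()
    ; P⊆D∪W        = inj₂
    ; s∉D          = λ ()
    ; saturated    = λ c → contradiction c no-consequence
    ; cut-sound    = λ ()
    ; cut-complete = λ _ ()
    ; and-sound    = λ ()
    ; and-complete = λ ()
    }

  module Step {P rest D : List Seq} {pc : Fm → List Fm} {pa : Fm → Fm → List Fm} {a b : Fm}
              (I : Invariant (st P ((a , b) ∷ rest) pc pa) D) (ab≉s : ¬ (a , b) ≈ s) where

    open Invariant I

    pc′ : Fm → List Fm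
    pc′ = recordCut b a (recordCut a b pc)

    pa′ : Fm → Fm → List Fm
    pa′ = conjUpd b a (conjUpd a b pa)

    candidates : Fm → Fm → List Fm
    candidates φ ψ = disj φ ++ pa′ ψ φ ++ pc′ φ

    pushedˡ pushedʳ pushed⁼ pushed : List Seq
    pushedˡ = map (_, b) (candidates a b)
    pushedʳ = map (a ,_) (candidates b a)
    pushed⁼ = map (_, a) (if eqF a b then SF else [])
    pushed  = pushedˡ ++ pushedʳ ++ pushed⁼

    open Insertion (insertion P rest pushed) public

    D′ : List Seq
    D′ = (a , b) ∷ D

    process≡ : process (a , b) rest (st P ((a , b) ∷ rest) pc pa) ≡ st (new ++ P) (new ++ rest) pc′ pa′
    process≡ = cong (λ PW → st (proj₁ PW) (proj₂ PW) pc′ pa′)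
      (trans (sym (trans (foldl-++ addNew (P , rest) pushedˡ (pushedʳ ++ pushed⁼))
                         (foldl-++ addNew (foldl addNew (P , rest) pushedˡ) pushedʳ pushed⁼)))
             result)

    cut-sound′ : φ ∈ pc′ γ → ∃[ δ ] (γ ≡ inv δ × δ ∈ AF × (δ , φ) ∈≈ D′)
    cut-sound′ m with ∈-recordCut⁻ m
    ... | inj₁ (b∈AF , refl , refl) = b , refl , b∈AF , here (inj₂ refl)
    ... | inj₂ m′ with ∈-recordCut⁻ m′
    ...   | inj₁ (a∈AF , refl , refl) = a , refl , a∈AF , here (inj₁ refl)
    ...   | inj₂ m″ = Product.map₂ (Product.map₂ (Product.map₂ there)) (cut-sound m″)

    cut-complete′ : γ ∈ AF → (γ , φ) ∈≈ D′ → φ ∈ pc′ (inv γ)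
    cut-complete′ γ∈AF (here (inj₁ refl)) = ∈-recordCut⁺ (inj₂ (∈-recordCut⁺ (inj₁ (γ∈AF , refl , refl))))
    cut-complete′ γ∈AF (here (inj₂ refl)) = ∈-recordCut⁺ (inj₁ (γ∈AF , refl , refl))
    cut-complete′ γ∈AF (there p)          = ∈-recordCut⁺ (inj₂ (∈-recordCut⁺ (inj₂ (cut-complete γ∈AF p))))

    and-sound′ : χ ∈ pa′ Γ ψ → χ ∈ SF × ∃[ φ ] (ConjOf φ ψ χ × (φ , Γ) ∈≈ D′)
    and-sound′ m with ∈-conjUpd⁻ m
    ... | inj₂ (refl , χ∈SF , c) = χ∈SF , b , c , here (inj₂ refl)
    ... | inj₁ m′ with ∈-conjUpd⁻ m′
    ...   | inj₂ (refl , χ∈SF , c) = χ∈SF , a , c , here (inj₁ refl)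
    ...   | inj₁ m″ = Product.map₂ (Product.map₂ (Product.map₂ there)) (and-sound m″)

    and-complete′ : (φ , Γ) ∈≈ D′ → χ ∈ SF → ConjOf φ ψ χ → χ ∈ pa′ Γ ψ
    and-complete′ (here (inj₁ refl)) χ∈SF c = ∈-conjUpd⁺ (inj₁ (∈-conjUpd⁺ (inj₂ (refl , χ∈SF , c))))
    and-complete′ (here (inj₂ refl)) χ∈SF c = ∈-conjUpd⁺ (inj₂ (refl , χ∈SF , c))
    and-complete′ (there p)          χ∈SF c = ∈-conjUpd⁺ (inj₁ (∈-conjUpd⁺ (inj₁ (and-complete p χ∈SF c))))

    candidate-consequence : (φ , ψ) ∈≈ D′ → χ ∈ candidates φ ψ → Consequence D′ χ ψ
    candidate-consequence {φ} φψ m with ∈-++⁻ (disj φ) m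
    ... | inj₁ m′ with ∈-disj⁻ m′
    ...   | χ∈SF , _ , inj₁ refl = by-∨₁ φψ χ∈SF
    ...   | χ∈SF , _ , inj₂ refl = by-∨₂ φψ χ∈SF
    candidate-consequence {φ} {ψ} φψ m | inj₂ m′ with ∈-++⁻ (pa′ ψ φ) m′
    ... | inj₁ m″ with and-sound′ m″
    ...   | χ∈SF , _ , inj₁ refl , χ′ψ = by-∧ χ′ψ φψ χ∈SF
    ...   | χ∈SF , _ , inj₂ refl , χ′ψ = by-∧ φψ χ′ψ χ∈SF
    candidate-consequence φψ m | inj₂ m′ | inj₂ m″ with cut-sound′ m″
    ... | _ , refl , δ∈AF , δχ = by-cut δ∈AF δχ φψ

    D′-sound : q ∈≈ D′ → Sound q
    D′-sound = ∈≈-sound λ { (here refl) → P-sound (W⊆P (here refl)) ; (there m) → P-sound (D⊆P m) }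

    pushed-sound : q ∈ pushed → Sound q
    pushed-sound m with ∈-++⁻ pushedˡ m
    ... | inj₁ mˡ with ∈-map⁻ (_, b) mˡ
    ...   | _ , χ∈ , refl = consequence-sound D′-sound (candidate-consequence (here (inj₁ refl)) χ∈)
    pushed-sound m | inj₂ m′ with ∈-++⁻ pushedʳ m′
    ... | inj₁ mʳ with ∈-map⁻ (a ,_) mʳ
    ...   | _ , χ∈ , refl =
      sound-swap (consequence-sound D′-sound (candidate-consequence (here (inj₂ refl)) χ∈))
    pushed-sound m | inj₂ m′ | inj₂ m⁼ with eqF a b | eqF-reflects a b
    ... | true | ofʸ refl with ∈-map⁻ (_, a) m⁼
    ...   | _ , χ∈SF , refl = consequence-sound D′-sound (by-replace (here (inj₁ refl)) χ∈SF)

    old : (φ , ψ) ∈≈ P → (φ , ψ) ∈≈ new ++ P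
    old = Any-resp-⊆ (xs⊆ys++xs P new)

    candidates-pushed : (φ , ψ) ≈ (a , b) → χ ∈ candidates φ ψ → (χ , ψ) ∈≈ new ++ P
    candidates-pushed (inj₁ refl) m = qs⊆≈ (∈-++⁺ˡ (∈-map⁺ (_, b) m))
    candidates-pushed (inj₂ refl) m = ∈≈-swap (qs⊆≈ (∈-++⁺ʳ pushedˡ (∈-++⁺ˡ (∈-map⁺ (a ,_) m))))

    replace-pushed : (Γ , Γ) ≈ (a , b) → Δ ∈ SF → (Δ , Γ) ∈≈ new ++ P
    replace-pushed (inj₁ refl) = pushed-replace
      where
      pushed-replace : Δ ∈ SF → (Δ , a) ∈≈ new ++ P
      pushed-replace {Δ} Δ∈SF = qs⊆≈ (∈-++⁺ʳ pushedˡ (∈-++⁺ʳ pushedʳ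
        (∈-map⁺ (_, a) (subst (λ c → Δ ∈ (if c then SF else [])) (sym (≡⇒eqF {a} refl)) Δ∈SF))))
    replace-pushed (inj₂ refl) = replace-pushed (inj₁ refl)

    saturated′ : Consequence D′ φ ψ → (φ , ψ) ∈≈ new ++ P
    saturated′ (by-∨₁ (here e) m)          = candidates-pushed e (∈-++⁺ˡ (∈-disj⁺ m (_ , inj₁ refl)))
    saturated′ (by-∨₁ (there p) m)         = old (saturated (by-∨₁ p m))
    saturated′ (by-∨₂ (here e) m)          = candidates-pushed e (∈-++⁺ˡ (∈-disj⁺ m (_ , inj₂ refl)))
    saturated′ (by-∨₂ (there p) m)         = old (saturated (by-∨₂ p m))
    saturated′ (by-∧ p (here e) m)         =
      candidates-pushed e (∈-++⁺ʳ (disj _) (∈-++⁺ˡ (and-complete′ p m (inj₁ refl))))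
    saturated′ (by-∧ (here e) (there p) m) =
      candidates-pushed e (∈-++⁺ʳ (disj _) (∈-++⁺ˡ (and-complete′ (there p) m (inj₂ refl))))
    saturated′ (by-∧ (there p) (there p′) m) = old (saturated (by-∧ p p′ m))
    saturated′ (by-cut g p (here e))       =
      candidates-pushed e (∈-++⁺ʳ (disj _) (∈-++⁺ʳ (pa′ _ _) (cut-complete′ g p)))
    saturated′ (by-cut {γ = γ} g (here e) (there p)) =
      ∈≈-swap (candidates-pushed e (∈-++⁺ʳ (disj _) (∈-++⁺ʳ (pa′ _ _)
        (subst (λ δ → _ ∈ pc′ δ) (inv-involutive γ) (cut-complete′ (AF-inv g) (there p))))))
    saturated′ (by-cut g (there p) (there p′)) = old (saturated (by-cut g p p′))
    saturated′ (by-replace (here e) m)     = replace-pushed e m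
    saturated′ (by-replace (there p) m)    = old (saturated (by-replace p m))

    invariant′ : Invariant (st (new ++ P) (new ++ rest) pc′ pa′) D′
    invariant′ = record
      { P-sound      = Sum.[ pushed-sound ∘ new⊆qs , P-sound ]′ ∘ ∈-++⁻ new
      ; P-unique     = unique P-unique
      ; initSet⊆P    = ∈-++⁺ʳ new ∘ initSet⊆P
      ; W⊆P          = Sum.[ ∈-++⁺ˡ , ∈-++⁺ʳ new ∘ W⊆P ∘ there ]′ ∘ ∈-++⁻ new
      ; D⊆P          = λ { (here refl) → ∈-++⁺ʳ new (W⊆P (here refl)) ; (there m) → ∈-++⁺ʳ new (D⊆P m) }
      ; P⊆D∪W        = Sum.[ inj₂ ∘ ∈-++⁺ˡ , old-P⊆D∪W ]′ ∘ ∈-++⁻ new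
      ; s∉D          = λ { (here refl) → ab≉s ; (there m) → s∉D m }
      ; saturated    = saturated′
      ; cut-sound    = cut-sound′
      ; cut-complete = cut-complete′
      ; and-sound    = and-sound′
      ; and-complete = and-complete′
      }
      where
      old-P⊆D∪W : q ∈ P → q ∈ D′ ⊎ q ∈ new ++ rest
      old-P⊆D∪W m with P⊆D∪W m
      ... | inj₁ d           = inj₁ (there d)
      ... | inj₂ (here refl) = inj₁ (here refl)
      ... | inj₂ (there r)   = inj₂ (∈-++⁺ʳ new r)

  AF? : Decidable (_∈ AF)
  AF? φ = memF φ AF because memF-reflects φ AF

  open AnalyticCalculus A (_∈ AF) AF? AF-inv axiom∈AF using (cut-elimination; Closed; analytic⊆closed)

  saturated⇒underivable : ∀ {P pc pa D} → Invariant (st P [] pc pa) D → ¬ Derivable A s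
  saturated⇒underivable {P} {D = D} I d = s∉≈D (toD s∈≈P)
    where
    open Invariant I
    P⊆D : P ⊆ D
    P⊆D m = Sum.[ id , (λ ()) ]′ (P⊆D∪W m)
    toD : (φ , ψ) ∈≈ P → (φ , ψ) ∈≈ D
    toD = Any-resp-⊆ P⊆D
    closed : Closed (_∈ SF) SF-∧ SF-∨ AF⊆SF (λ φ ψ → (φ , ψ) ∈≈ P)
    closed = record
      { exchangeˢ = ∈≈-swap
      ; axiomˢ    = λ p → Any-resp-⊆ initSet⊆P (initList⊆≈initSet (∈-++⁺ˡ p))
      ; hypˢ      = λ x pos∈SF → Any-resp-⊆ initSet⊆P
                      (initList⊆≈initSet (∈-++⁺ʳ A (∈-map⁺ (λ x → pos x , neg x) (pos∈SF⇒var pos∈SF))))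
      ; ∨₁ˢ       = λ p m → saturated (by-∨₁ (toD p) m)
      ; ∨₂ˢ       = λ p m → saturated (by-∨₂ (toD p) m)
      ; ∧ˢ        = λ p p′ m → saturated (by-∧ (toD p) (toD p′) m)
      ; cutˢ      = λ c p p′ → saturated (by-cut c (toD p) (toD p′))
      ; replaceˢ  = λ p m → saturated (by-replace (toD p) m)
      }
    s∈≈P : s ∈≈ P
    s∈≈P = analytic⊆closed (_∈ SF) SF-∧ SF-∨ AF⊆SF closed (proj₂ (cut-elimination d))
                           (proj₁ s∈SF) (proj₂ s∈SF)
    s∉≈D : ¬ s ∈≈ D
    s∉≈D m with find m
    ... | _ , r∈D , s≈r = s∉D r∈D (≈-sym s≈r)

  bound : ℕ
  bound = length (cartesianProduct SF SF)

  P≤bound : ∀ {σ D} → Invariant σ D → length (P σ) ≤ bound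
  P≤bound {σ} I = unique⊆⇒length≤ (AllPairs.map (λ q≉r q≡r → q≉r (inj₁ q≡r)) P-unique) P⊆SF²
    where
    open Invariant I
    P⊆SF² : P σ ⊆ cartesianProduct SF SF
    P⊆SF² m = ∈-cartesianProduct⁺ (proj₁ (proj₂ (P-sound m))) (proj₂ (proj₂ (P-sound m)))

  popped-sound : ∀ {P rest pc pa D} → Invariant (st P (q ∷ rest) pc pa) D → Sound q
  popped-sound I = Invariant.P-sound I (Invariant.W⊆P I (here refl))

  run-correct : ∀ n σ D → Invariant σ D → length (W σ) + bound < length (P σ) + n →
                ∃[ r ] (run n σ ≡ just r × (r ≡ true ⇔ Derivable A s))
  run-correct zero σ D I fuel =
    contradiction (≤-trans fuel (≤-trans (≤-reflexive (+-identityʳ _)) (P≤bound I)))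
                  (m+n≮n (length (W σ)) bound)
  run-correct (suc n) (st P [] pc pa) D I fuel =
    false , refl , mk⇔ (λ ()) (λ d → contradiction d (saturated⇒underivable I))
  run-correct (suc n) (st P ((a , b) ∷ rest) pc pa) D I fuel with eqS (a , b) s | eqS-reflects (a , b) s
  ... | true  | ofʸ (inj₁ refl) = true , refl , mk⇔ (λ _ → proj₁ (popped-sound I)) (λ _ → refl)
  ... | true  | ofʸ (inj₂ refl) = true , refl , mk⇔ (λ _ → swap (proj₁ (popped-sound I))) (λ _ → refl)
  ... | false | ofⁿ ab≉s =
    subst (λ σ → ∃[ r ] (run n σ ≡ just r × _)) (sym process≡)
      (run-correct n _ ((a , b) ∷ D) invariant′ (fuel-step new rest P fuel))
    where open Step I ab≉s

mainTheorem1 : (s : Seq) (A : List Seq) →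
    Σ ℕ (λ n → Σ Bool (λ r → (prove n s A ≡ just r) × ((r ≡ true) ⇔ Derivable A s)))
mainTheorem1 s A = suc bound , run-correct (suc bound) initState [] initial-invariant fuel
  where
  open Procedure s A using (initState; initSet)
  open Correctness s A
  fuel : length initSet + bound < length initSet + suc bound
  fuel = +-monoʳ-< (length initSet) (n<1+n bound)
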